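{- A finite set $\mathcal{HC}$ of propositional Horn clauses has the termination property if and only if it is recursion-free.
   Context: A propositional literal is a Boolean variable $p$ (positive) or its negation $\neg p$ (negative). A clause is a disjunction of literals, regarded as a multiset of literals (multiplicities matter). A Horn clause is a clause with at most one positive literal. For a set $\mathcal{HC}$ of Horn clauses, the dependence relation $\to_{\mathcal{HC}}$ on Boolean variables is defined by $p\to_{\mathcal{HC}} q$ iff some clause of $\mathcal{HC}$ contains $p$ positively and $q$ negatively; $\mathcal{HC}$ is recursion-free if $\to_{\mathcal{HC}}$ is acyclic. A set $\mathcal C$ of clauses has the termination property if there is no infinite sequence $c_0,c_1,c_2,\dots$ of clauses with $c_0\in\mathcal C$ and, for each $i\ge1$, $c_i$ derived by binary resolution from $c_{i-1}$ and a clause of $\mathcal C$, using the rule: from $C\vee p$ and $D\vee\neg p$ derive $C\vee D$. -}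

module Defs where

open import Data.Nat using (ℕ; zero; suc; _≤_)
open import Data.List using (List; []; _∷_; _++_)
open import Data.List.Membership.Propositional using (_∈_)
open import Data.List.Relation.Binary.Permutation.Propositional using (_↭_)
open import Data.Product using (Σ; ∃; _×_; _,_)
open import Data.Sum using (_⊎_)
open import Relation.Nullary using (¬_)
open import Relation.Binary.Construct.Closure.Transitive using (TransClosure)

Var : Set
Var = ℕ

data Literal : Set where
  pos : Var → Literal
  neg : Var → Literal

-- A clause is a multiset of literals, represented by a list;
-- clauses are identified up to permutation (_↭_) where it matters.
Clause : Set
Clause = List Literal

ClauseSet : Set
ClauseSet = List Clause

posCount : Clause → ℕ
posCount [] = 0
posCount (pos _ ∷ c) = suc (posCount c)
posCount (neg _ ∷ c) = posCount c

IsHorn : Clause → Set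
IsHorn c = posCount c ≤ 1

AllHorn : ClauseSet → Set
AllHorn HC = ∀ c → c ∈ HC → IsHorn c

Resolvent : Clause → Clause → Clause → Set
Resolvent c d e =
  Σ Var λ p → Σ Clause λ C → Σ Clause λ D →
    (c ↭ (pos p ∷ C)) × (d ↭ (neg p ∷ D)) × (e ↭ (C ++ D))

Step : ClauseSet → Clause → Clause → Set
Step 𝒞 c e = Σ Clause λ d → d ∈ 𝒞 × (Resolvent c d e ⊎ Resolvent d c e)

Termination : ClauseSet → Set
Termination 𝒞 =
  ¬ (Σ (ℕ → Clause) λ f → (f 0 ∈ 𝒞) × (∀ i → Step 𝒞 (f i) (f (suc i))))

Dep : ClauseSet → Var → Var → Set
Dep HC p q = Σ Clause λ c → c ∈ HC × (pos p ∈ c) × (neg q ∈ c)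

RecursionFree : ClauseSet → Set
RecursionFree HC = ∀ p → ¬ TransClosure (Dep HC) p p

module Submission where

-- A finite set HC of Horn clauses terminates iff its dependence relation →
-- is acyclic.
-- (⇒) On a cycle through p, a clause containing p and some ¬q with q →⁺ p
-- resolves on q with the clause witnessing the first edge q → q' of that
-- path, yielding p and ¬q' with q' →⁺ p: an infinite derivation.
-- (⇐) Termination is a negation, so we may assume →⁺ decidable (it lives on
-- the finitely many variables of HC).  With  above v = #{u | u →⁺ v}  and
-- below v = #{u | v →⁺ u}, every step between Horn clauses lowers
--     ( Σ_{p ∈ c} (1 + above p) ,  Σ_{¬q ∈ c} tower (below q) )
-- lexicographically, where tower (k+1) = 1 + N · tower k and N bounds the
-- clause lengths of HC.

open import Defs
open import Function.Base using (_∘_; flip)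
open import Function.Bundles using (_⇔_; mk⇔)
open import Data.Nat using (ℕ; zero; suc; _+_; _*_; _≤_; _<_; z≤n; s≤s)
open import Data.Nat.Properties
  using (_≟_; ≤-trans; ≤-reflexive; ≤-pred; n≤0⇒n≡0; n≤1+n; n<1+n; +-identityʳ;
         +-mono-≤; +-monoˡ-<; +-mono-<-≤; +-mono-≤-<; *-monoʳ-≤; *-monoˡ-≤; *-zeroʳ;
         m≤m+n; m≤n+m; module ≤-Reasoning)
open import Data.Nat.Induction using (<-wellFounded)
open import Data.Nat.ListAction using (sum)
open import Data.Nat.ListAction.Properties using (sum-++; sum-↭)
open import Data.List using (List; []; _∷_; _++_; map; length; concat; cartesianProduct)
open import Data.List.Properties using (map-++)
open import Data.List.Membership.Propositional using (_∈_)
open import Data.List.Membership.Propositional.Properties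
  using (∈-++⁺ˡ; ∈-++⁺ʳ; ∈-∃++; ∈-map⁺; ∈-concat⁺′; ∈-cartesianProduct⁺)
import Data.List.Membership.DecPropositional as DecMembership
open import Data.List.Relation.Unary.Any using (here; there)
open import Data.List.Relation.Unary.All as All using (All)
open import Data.List.Relation.Binary.Permutation.Propositional using (_↭_; ↭-sym; ↭-refl)
open import Data.List.Relation.Binary.Permutation.Propositional.Properties
  using (∈-resp-↭; shift; map⁺; ↭-length)
open import Data.Product using (Σ; _×_; _,_; proj₁; proj₂; uncurry)
open import Data.Product.Properties using (≡-dec)
open import Data.Product.Relation.Binary.Lex.Strict using (×-Lex; ×-wellFounded)
open import Data.Sum using (inj₁; inj₂)
open import Data.Empty using (⊥)
open import Level using (0ℓ)
open import Induction.WellFounded using (WellFounded; Acc; acc)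
open import Relation.Binary.Core using (Rel)
open import Relation.Binary.Definitions using (DecidableEquality) renaming (Decidable to Decidable₂)
open import Relation.Binary.PropositionalEquality using (_≡_; refl; sym; trans; cong; module ≡-Reasoning)
open import Relation.Binary.Construct.Closure.Transitive using (TransClosure; [_]; _∷_; _∷ʳ_)
open import Relation.Nullary using (¬_; Dec; yes; no)
open import Relation.Nullary.Decidable using (¬¬-excluded-middle)
open import Relation.Nullary.Negation using (¬¬-map; ¬¬-Monad)
open import Relation.Unary using (Pred; Decidable)

private
  variable
    A : Set
    R : Rel A 0ℓ
    x y : A
    p q a b : Var
    c d e C D : Clause

weight : (Literal → ℕ) → Clause → ℕ
weight w c = sum (map w c)

weight-↭ : ∀ w → c ↭ d → weight w c ≡ weight w d
weight-↭ w c↭d = sum-↭ (map⁺ w c↭d)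

weight-++ : ∀ w C D → weight w (C ++ D) ≡ weight w C + weight w D
weight-++ w C D = trans (cong sum (map-++ w C D)) (sum-++ (map w C) (map w D))

weight-≤ : ∀ w t C → (∀ {l} → l ∈ C → w l ≤ t) → weight w C ≤ length C * t
weight-≤ w t []      bound = z≤n
weight-≤ w t (l ∷ C) bound = +-mono-≤ (bound (here refl)) (weight-≤ w t C (bound ∘ there))

isPositive : Literal → ℕ
isPositive (pos _) = 1
isPositive (neg _) = 0

posCount-weight : ∀ c → posCount c ≡ weight isPositive c
posCount-weight []          = refl
posCount-weight (pos _ ∷ c) = cong suc (posCount-weight c)
posCount-weight (neg _ ∷ c) = posCount-weight c

posCount-↭ : c ↭ d → posCount c ≡ posCount d
posCount-↭ {c} {d} c↭d = begin
  posCount c            ≡⟨ posCount-weight c ⟩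
  weight isPositive c   ≡⟨ weight-↭ isPositive c↭d ⟩
  weight isPositive d   ≡⟨ sym (posCount-weight d) ⟩
  posCount d            ∎
  where open ≡-Reasoning

posCount-++ : ∀ C D → posCount (C ++ D) ≡ posCount C + posCount D
posCount-++ []          D = refl
posCount-++ (pos _ ∷ C) D = cong suc (posCount-++ C D)
posCount-++ (neg _ ∷ C) D = posCount-++ C D

horn-remainder : IsHorn c → c ↭ pos p ∷ C → posCount C ≡ 0
horn-remainder hc c↭ = n≤0⇒n≡0 (≤-pred (≤-trans (≤-reflexive (sym (posCount-↭ c↭))) hc))

-- Binary resolution preserves the Horn property: the positive premise
-- contributes only negative literals to the resolvent.
resolvent-horn : IsHorn c → IsHorn d → Resolvent c d e → IsHorn e
resolvent-horn {c} {d} {e} hc hd (p , C , D , c↭ , d↭ , e↭) = begin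
  posCount e                ≡⟨ posCount-↭ e↭ ⟩
  posCount (C ++ D)         ≡⟨ posCount-++ C D ⟩
  posCount C + posCount D   ≡⟨ cong (_+ posCount D) (horn-remainder hc c↭) ⟩
  posCount D                ≡⟨ sym (posCount-↭ d↭) ⟩
  posCount d                ≤⟨ hd ⟩
  1                         ∎
  where open ≤-Reasoning

derivation-horn : ∀ {𝒞} → AllHorn 𝒞 → (f : ℕ → Clause) → f 0 ∈ 𝒞 →
                  (∀ i → Step 𝒞 (f i) (f (suc i))) → ∀ i → IsHorn (f i)
derivation-horn horn f f₀∈𝒞 steps zero = horn (f 0) f₀∈𝒞
derivation-horn horn f f₀∈𝒞 steps (suc i) with steps i
... | d , d∈𝒞 , inj₁ res = resolvent-horn (derivation-horn horn f f₀∈𝒞 steps i) (horn d d∈𝒞) res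
... | d , d∈𝒞 , inj₂ res = resolvent-horn (horn d d∈𝒞) (derivation-horn horn f f₀∈𝒞 steps i) res

weight-negative : ∀ w → (∀ v → w (neg v) ≡ 0) → ∀ C → posCount C ≡ 0 → weight w C ≡ 0
weight-negative w w-neg []          _     = refl
weight-negative w w-neg (neg v ∷ C) noPos =
  trans (cong (_+ weight w C) (w-neg v)) (weight-negative w w-neg C noPos)

horn-weight-≤ : ∀ w b → (∀ v → w (neg v) ≡ 0) → ∀ D → posCount D ≤ 1 →
                (∀ {r} → pos r ∈ D → w (pos r) ≤ b) → weight w D ≤ b
horn-weight-≤ w b w-neg []          _  _     = z≤n
horn-weight-≤ w b w-neg (pos r ∷ D) hD bound = begin
  w (pos r) + weight w D   ≡⟨ cong (w (pos r) +_) (weight-negative w w-neg D (n≤0⇒n≡0 (≤-pred hD))) ⟩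
  w (pos r) + 0            ≡⟨ +-identityʳ (w (pos r)) ⟩
  w (pos r)                ≤⟨ bound (here refl) ⟩
  b                        ∎
  where open ≤-Reasoning
horn-weight-≤ w b w-neg (neg v ∷ D) hD bound = begin
  w (neg v) + weight w D   ≡⟨ cong (_+ weight w D) (w-neg v) ⟩
  weight w D               ≤⟨ horn-weight-≤ w b w-neg D hD (bound ∘ there) ⟩
  b                        ∎
  where open ≤-Reasoning

remove : ∀ {l} → l ∈ c → Σ Clause λ C → c ↭ l ∷ C
remove {l = l} l∈c with C₁ , C₂ , refl ← ∈-∃++ l∈c = C₁ ++ C₂ , shift l C₁ C₂

resolve-keeping : pos q ∈ d → neg q ∈ c → neg a ∈ d → pos b ∈ c →
                  Σ Clause λ e → Resolvent d c e × neg a ∈ e × pos b ∈ e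
resolve-keeping {q} q∈d ¬q∈c ¬a∈d b∈c with C , d↭ ← remove q∈d | D , c↭ ← remove ¬q∈c =
  C ++ D , (q , C , D , d↭ , c↭ , ↭-refl) ,
  ∈-++⁺ˡ (negative-tail (∈-resp-↭ d↭ ¬a∈d)) , ∈-++⁺ʳ C (positive-tail (∈-resp-↭ c↭ b∈c))
  where
    negative-tail : neg a ∈ pos q ∷ C → neg a ∈ C
    negative-tail (there m) = m
    positive-tail : pos b ∈ neg q ∷ D → pos b ∈ D
    positive-tail (there m) = m

unfold-derivation : ∀ 𝒞 (Inv : Clause → Set) → Σ Clause (λ c → c ∈ 𝒞 × Inv c) →
                    (∀ {c} → Inv c → Σ Clause λ e → Step 𝒞 c e × Inv e) → ¬ Termination 𝒞
unfold-derivation 𝒞 Inv (c₀ , c₀∈𝒞 , inv₀) advance termination =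
  termination (proj₁ ∘ derivation , c₀∈𝒞 , λ i → proj₁ (proj₂ (advance (proj₂ (derivation i)))))
  where
    derivation : ℕ → Σ Clause Inv
    derivation zero    = c₀ , inv₀
    derivation (suc i) = proj₁ (advance (proj₂ (derivation i))) , proj₂ (proj₂ (advance (proj₂ (derivation i))))

first-edge : TransClosure R p p → TransClosure R q p → Σ Var λ q' → R q q' × TransClosure R q' p
first-edge cycle [ r ]    = _ , r , cycle
first-edge cycle (r ∷ rs) = _ , r , rs

OnCycle : ClauseSet → Var → Clause → Set
OnCycle HC p c = Σ Var λ q → pos p ∈ c × neg q ∈ c × TransClosure (Dep HC) q p

cycle⇒non-terminating : ∀ HC p → TransClosure (Dep HC) p p → ¬ Termination HC
cycle⇒non-terminating HC p cycle = unfold-derivation HC (OnCycle HC p) start advance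
  where
    start : Σ Clause λ c → c ∈ HC × OnCycle HC p c
    start with q , (c , c∈HC , p∈c , ¬q∈c) , path ← first-edge cycle cycle =
      c , c∈HC , q , p∈c , ¬q∈c , path

    advance : OnCycle HC p c → Σ Clause λ e → Step HC c e × OnCycle HC p e
    advance (q , p∈c , ¬q∈c , path) with first-edge cycle path
    ... | q' , (d , d∈HC , q∈d , ¬q'∈d) , path' with resolve-keeping q∈d ¬q∈c ¬q'∈d p∈c
    ...   | e , res , ¬q'∈e , p∈e = e , (d , d∈HC , inj₂ res) , q' , p∈e , ¬q'∈e , path'

-- Over a finite support in a type with decidable equality, decidability of
-- a predicate holds in the double-negation monad (one instance of excluded
-- middle per element of the support).
¬¬-decidable : {P : Pred A 0ℓ} → DecidableEquality A → (xs : List A) → (∀ {x} → P x → x ∈ xs) → ¬ ¬ Decidable P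
¬¬-decidable {P = P} _≟ₐ_ xs support =
  ¬¬-map decideWith (All.sequenceM 0ℓ ¬¬-Monad (All.tabulate λ _ → ¬¬-excluded-middle))
  where
    decideWith : All (Dec ∘ P) xs → Decidable P
    decideWith table x with DecMembership._∈?_ _≟ₐ_ x xs
    ... | yes x∈xs = All.lookup table x∈xs
    ... | no  x∉xs = no (x∉xs ∘ support)

¬¬-decidable₂ : DecidableEquality A → (L : List A) → (∀ {x y} → R x y → x ∈ L × y ∈ L) →
                ¬ ¬ Decidable₂ R
¬¬-decidable₂ {R = R} _≟ₐ_ L inField =
  ¬¬-map (λ decide x y → decide (x , y))
         (¬¬-decidable (≡-dec _≟ₐ_ _≟ₐ_) (cartesianProduct L L) (uncurry ∈-cartesianProduct⁺ ∘ inField))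

closure-field : ∀ {L} → (∀ {x y} → R x y → x ∈ L × y ∈ L) →
                TransClosure R x y → x ∈ L × y ∈ L
closure-field inField [ r ]    = inField r
closure-field inField (r ∷ rs) = proj₁ (inField r) , proj₂ (closure-field inField rs)

indicator : ∀ {X : Set} → Dec X → ℕ
indicator (yes _) = 1
indicator (no _)  = 0

count : {P : Pred A 0ℓ} → Decidable P → List A → ℕ
count P? []       = 0
count P? (x ∷ xs) = indicator (P? x) + count P? xs

indicator-mono : ∀ {X Y : Set} → (X → Y) → (x? : Dec X) (y? : Dec Y) → indicator x? ≤ indicator y?
indicator-mono f (yes x) (yes _) = s≤s z≤n
indicator-mono f (yes x) (no ¬y) with () ← ¬y (f x)
indicator-mono f (no _)  y?      = z≤n

indicator-strict : ∀ {X Y : Set} → ¬ X → Y → (x? : Dec X) (y? : Dec Y) → indicator x? < indicator y?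
indicator-strict ¬x y (yes x) y?      with () ← ¬x x
indicator-strict ¬x y (no _)  (yes _) = s≤s z≤n
indicator-strict ¬x y (no _)  (no ¬y) with () ← ¬y y

count-mono : {P Q : Pred A 0ℓ} (P? : Decidable P) (Q? : Decidable Q) → (∀ {x} → P x → Q x) →
             ∀ xs → count P? xs ≤ count Q? xs
count-mono P? Q? P⊆Q []       = z≤n
count-mono P? Q? P⊆Q (x ∷ xs) = +-mono-≤ (indicator-mono P⊆Q (P? x) (Q? x)) (count-mono P? Q? P⊆Q xs)

count-strict : {P Q : Pred A 0ℓ} (P? : Decidable P) (Q? : Decidable Q) → (∀ {x} → P x → Q x) →
               ∀ xs → y ∈ xs → Q y → ¬ P y → count P? xs < count Q? xs
count-strict P? Q? P⊆Q (x ∷ xs) (here refl) Qy ¬Py =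
  +-mono-<-≤ (indicator-strict ¬Py Qy (P? x) (Q? x)) (count-mono P? Q? P⊆Q xs)
count-strict P? Q? P⊆Q (x ∷ xs) (there y∈xs) Qy ¬Py =
  +-mono-≤-< (indicator-mono P⊆Q (P? x) (Q? x)) (count-strict P? Q? P⊆Q xs y∈xs Qy ¬Py)

module Ranks (R : Rel A 0ℓ) (reach? : Decidable₂ (TransClosure R))
             (acyclic : ∀ x → ¬ TransClosure R x x)
             (L : List A) (inField : ∀ {x y} → R x y → x ∈ L × y ∈ L) where

  below : A → ℕ
  below x = count (reach? x) L

  above : A → ℕ
  above x = count (flip reach? x) L

  below-decreasing : R x y → below y < below x
  below-decreasing {x} {y} r =
    count-strict (reach? y) (reach? x) (r ∷_) L (proj₂ (inField r)) [ r ] (acyclic y)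

  above-increasing : R x y → above x < above y
  above-increasing {x} {y} r =
    count-strict (flip reach? x) (flip reach? y) (_∷ʳ r) L (proj₁ (inField r)) [ r ] (acyclic x)

var : Literal → Var
var (pos v) = v
var (neg v) = v

variables : ClauseSet → List Var
variables HC = concat (map (map var) HC)

dep-variables : ∀ {HC} → Dep HC p q → p ∈ variables HC × q ∈ variables HC
dep-variables (c , c∈HC , p∈c , ¬q∈c) =
  ∈-concat⁺′ (∈-map⁺ var p∈c) (∈-map⁺ (map var) c∈HC) ,
  ∈-concat⁺′ (∈-map⁺ var ¬q∈c) (∈-map⁺ (map var) c∈HC)

size : ClauseSet → ℕ
size HC = sum (map length HC)

length-≤-size : ∀ {HC} → c ∈ HC → length c ≤ size HC
length-≤-size {HC = c ∷ HC} (here refl) = m≤m+n (length c) (size HC)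
length-≤-size {HC = d ∷ HC} (there c∈HC) = ≤-trans (length-≤-size c∈HC) (m≤n+m (size HC) (length d))

-- tower N k: the weight of a negative literal of rank k.  N literals of
-- rank below k weigh less than one literal of rank k.
tower : ℕ → ℕ → ℕ
tower N zero    = 1
tower N (suc k) = suc (N * tower N k)

tower-mono : ∀ N {j k} → j ≤ k → tower N j ≤ tower N k
tower-mono N {k = zero}  z≤n        = s≤s z≤n
tower-mono N {k = suc k} z≤n        = s≤s z≤n
tower-mono N             (s≤s j≤k) = s≤s (*-monoʳ-≤ N (tower-mono N j≤k))

no-infinite-descent : ∀ {_⊏_ : Rel A 0ℓ} → WellFounded _⊏_ → (f : ℕ → A) →
                      ¬ (∀ i → f (suc i) ⊏ f i)
no-infinite-descent {_⊏_ = _⊏_} wf f descending = go 0 (wf (f 0))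
  where
    go : ∀ i → Acc _⊏_ (f i) → ⊥
    go i (acc smaller) = go (suc i) (smaller (descending i))

module Descent (HC : ClauseSet) (horn : AllHorn HC) (recursionFree : RecursionFree HC)
               (reach? : Decidable₂ (TransClosure (Dep HC))) where

  open Ranks (Dep HC) reach? recursionFree (variables HC) dep-variables

  posWeight : Literal → ℕ
  posWeight (pos v) = suc (above v)
  posWeight (neg _) = 0

  negWeight : Literal → ℕ
  negWeight (pos _) = 0
  negWeight (neg v) = tower (size HC) (below v)

  measure : Clause → ℕ × ℕ
  measure c = weight posWeight c , weight negWeight c

  _⊏_ : Rel (ℕ × ℕ) 0ℓ
  _⊏_ = ×-Lex _≡_ _<_ _<_

  remainder-length : d ∈ HC → d ↭ pos p ∷ C → length C ≤ size HC
  remainder-length d∈HC d↭ =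
    ≤-trans (n≤1+n _) (≤-trans (≤-reflexive (sym (↭-length d↭))) (length-≤-size d∈HC))

  negWeight-< : ∀ C k → length C ≤ size HC → (∀ {q} → neg q ∈ C → below q < k) →
                weight negWeight C < tower (size HC) k
  negWeight-< C zero _ ranked = s≤s (begin
    weight negWeight C   ≤⟨ weight-≤ negWeight 0 C literal ⟩
    length C * 0         ≡⟨ *-zeroʳ (length C) ⟩
    0                    ∎)
    where
      open ≤-Reasoning
      literal : ∀ {l} → l ∈ C → negWeight l ≤ 0
      literal {pos _} _   = z≤n
      literal {neg _} ¬q∈C with () ← ranked ¬q∈C
  negWeight-< C (suc k) len ranked = s≤s (begin
    weight negWeight C            ≤⟨ weight-≤ negWeight (tower (size HC) k) C literal ⟩
    length C * tower (size HC) k  ≤⟨ *-monoˡ-≤ (tower (size HC) k) len ⟩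
    size HC * tower (size HC) k   ∎)
    where
      open ≤-Reasoning
      literal : ∀ {l} → l ∈ C → negWeight l ≤ tower (size HC) k
      literal {pos _} _    = z≤n
      literal {neg _} ¬q∈C = tower-mono (size HC) (≤-pred (ranked ¬q∈C))

  -- Resolving c on its positive literal p lowers the positive weight:
  -- p is replaced by at most one positive literal r of the side clause, and r → p.
  positive-pivot : IsHorn c → d ∈ HC → Resolvent c d e → weight posWeight e < weight posWeight c
  positive-pivot {c} {d} {e} hc d∈HC (p , C , D , c↭ , d↭ , e↭) = begin-strict
    weight posWeight e                       ≡⟨ weight-↭ posWeight e↭ ⟩
    weight posWeight (C ++ D)                ≡⟨ weight-++ posWeight C D ⟩
    weight posWeight C + weight posWeight D  ≡⟨ cong (_+ weight posWeight D) C-weightless ⟩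
    weight posWeight D                       ≤⟨ horn-weight-≤ posWeight (above p) (λ _ → refl) D D-horn r<p ⟩
    above p                                  <⟨ n<1+n (above p) ⟩
    suc (above p)                            ≡⟨ sym (+-identityʳ (suc (above p))) ⟩
    suc (above p) + 0                        ≡⟨ cong (suc (above p) +_) (sym C-weightless) ⟩
    weight posWeight (pos p ∷ C)             ≡⟨ weight-↭ posWeight (↭-sym c↭) ⟩
    weight posWeight c                       ∎
    where
      open ≤-Reasoning
      C-weightless : weight posWeight C ≡ 0
      C-weightless = weight-negative posWeight (λ _ → refl) C (horn-remainder hc c↭)
      D-horn : posCount D ≤ 1
      D-horn = ≤-trans (≤-reflexive (posCount-↭ (↭-sym d↭))) (horn d d∈HC)
      r<p : ∀ {r} → pos r ∈ D → suc (above r) ≤ above p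
      r<p r∈D = above-increasing
        (d , d∈HC , ∈-resp-↭ (↭-sym d↭) (there r∈D) , ∈-resp-↭ (↭-sym d↭) (here refl))

  -- Resolving c on a negative literal ¬p keeps the positive weight and
  -- lowers the negative one: tower (below p) is replaced by at most
  -- size HC literals ¬q with p → q.
  negative-pivot : d ∈ HC → Resolvent d c e →
                   weight posWeight e ≡ weight posWeight c × weight negWeight e < weight negWeight c
  negative-pivot {d} {c} {e} d∈HC (p , C , D , d↭ , c↭ , e↭) = same-positive , smaller-negative
    where
      C-weightless : weight posWeight C ≡ 0
      C-weightless = weight-negative posWeight (λ _ → refl) C (horn-remainder (horn d d∈HC) d↭)

      same-positive : weight posWeight e ≡ weight posWeight c
      same-positive = begin
        weight posWeight e                       ≡⟨ weight-↭ posWeight e↭ ⟩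
        weight posWeight (C ++ D)                ≡⟨ weight-++ posWeight C D ⟩
        weight posWeight C + weight posWeight D  ≡⟨ cong (_+ weight posWeight D) C-weightless ⟩
        weight posWeight (neg p ∷ D)             ≡⟨ weight-↭ posWeight (↭-sym c↭) ⟩
        weight posWeight c                       ∎
        where open ≡-Reasoning

      q<p : ∀ {q} → neg q ∈ C → below q < below p
      q<p ¬q∈C = below-decreasing
        (d , d∈HC , ∈-resp-↭ (↭-sym d↭) (here refl) , ∈-resp-↭ (↭-sym d↭) (there ¬q∈C))

      smaller-negative : weight negWeight e < weight negWeight c
      smaller-negative = begin-strict
        weight negWeight e                          ≡⟨ weight-↭ negWeight e↭ ⟩
        weight negWeight (C ++ D)                   ≡⟨ weight-++ negWeight C D ⟩
        weight negWeight C + weight negWeight D     <⟨ +-monoˡ-< (weight negWeight D)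
                                                         (negWeight-< C (below p) (remainder-length d∈HC d↭) q<p) ⟩
        weight negWeight (neg p ∷ D)                ≡⟨ weight-↭ negWeight (↭-sym c↭) ⟩
        weight negWeight c                          ∎
        where open ≤-Reasoning

  step-decreases : IsHorn c → Step HC c e → measure e ⊏ measure c
  step-decreases hc (d , d∈HC , inj₁ res) = inj₁ (positive-pivot hc d∈HC res)
  step-decreases hc (d , d∈HC , inj₂ res) = inj₂ (negative-pivot d∈HC res)

  terminating : Termination HC
  terminating (f , f₀∈HC , steps) =
    no-infinite-descent (×-wellFounded <-wellFounded <-wellFounded) (measure ∘ f)
      (λ i → step-decreases (derivation-horn horn f f₀∈HC steps i) (steps i))

recursion-free⇒terminating : ∀ HC → AllHorn HC → RecursionFree HC → Termination HC
recursion-free⇒terminating HC horn recursionFree derivation =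
  ¬¬-decidable₂ _≟_ (variables HC) (closure-field dep-variables)
    (λ reach? → Descent.terminating HC horn recursionFree reach? derivation)

lemma5 : (HC : ClauseSet) → AllHorn HC → (Termination HC ⇔ RecursionFree HC)
lemma5 HC horn = mk⇔
  (λ termination p cycle → cycle⇒non-terminating HC p cycle termination)
  (recursion-free⇒terminating HC horn)
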